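{- Let $G$ be a simple bipartite graph with stable sets $X=\{x_i\}_{i=1}^s$ and $Y=\{y_j\}_{j=1}^t$, let $n\ge1$, and suppose $G\cong H_1\oplus H_2$ is a decomposition of $G$. Then there exist orientations $\overrightarrow{G}$ of $G$ and $\overrightarrow{K}_{1,n}^l$ of $K_{1,n}^l$ such that $S_{2n}(G;H_1,H_2)\cong\mathrm{und}(\overrightarrow{G}\otimes\overrightarrow{K}_{1,n}^l)$.
   Context: A decomposition $G\cong H_1\oplus H_2$ means $H_1,H_2$ are subgraphs of $G$ whose edge sets partition $E(G)$. $S_{2n}(G;H_1,H_2)$ is the graph with vertex set $X\cup Y\cup\bigcup_{k=1}^n X_k\cup\bigcup_{k=1}^n Y_k$, where $X_k=\{x_i^k\}_{i=1}^s$, $Y_k=\{y_j^k\}_{j=1}^t$ are new vertices, and edge set $E(G)\cup\{x_iy_j^k: x_iy_j\in E(H_1),\,k\in[1,n]\}\cup\{x_i^ky_j: x_iy_j\in E(H_2),\,k\in[1,n]\}$. $K_{1,n}^l$ is the star $K_{1,n}$ with a loop at its central vertex. For digraphs $D,F$, $D\otimes F$ has vertex set $V(D)\times V(F)$ and arc $((a,i),(b,j))$ iff $(a,b)\in E(D)$ and $(i,j)\in E(F)$ (a loop is an arc $(x,x)$); $\mathrm{und}$ denotes the underlying undirected graph. -}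

module Defs where

open import Data.Nat using (ℕ)
open import Data.Fin using (Fin)
open import Data.Sum using (_⊎_; inj₁; inj₂)
open import Data.Product using (Σ; _×_; _,_)
open import Data.Unit using (⊤)
open import Data.Empty using (⊥)
open import Relation.Nullary using (¬_)
open import Relation.Binary.PropositionalEquality using (_≡_)
open import Function.Bundles using (_↔_; _⇔_; Inverse)

-- A graph: a vertex type with an adjacency relation (loops allowed, used for K_{1,n}^l).
record Graph : Set₁ where
  field
    V   : Set
    Adj : V → V → Set
open Graph public

record Digraph : Set₁ where
  field
    DV  : Set
    Arc : DV → DV → Set
open Digraph public

Sym : {A : Set} → (A → A → Set) → A → A → Set
Sym R u v = R u v ⊎ R v u

_≅_ : Graph → Graph → Set
G ≅ H = Σ (V G ↔ V H) λ f →
  ∀ u v → Adj G u v ⇔ Adj H (Inverse.to f u) (Inverse.to f v)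

IsOrientation : (G : Graph) → (V G → V G → Set) → Set
IsOrientation G A =
  (∀ u v → Adj G u v ⇔ Sym A u v) × (∀ u v → A u v → A v u → u ≡ v)

dig : (G : Graph) → (V G → V G → Set) → Digraph
dig G A = record { DV = V G ; Arc = A }

_⊗_ : Digraph → Digraph → Digraph
D ⊗ F = record
  { DV  = DV D × DV F
  ; Arc = λ { (a , i) (b , j) → Arc D a b × Arc F i j } }

und : Digraph → Graph
und D = record { V = DV D ; Adj = Sym (Arc D) }

-- Simple bipartite graph with stable sets X = Fin s (vertices inj₁ i = x_i),
-- Y = Fin t (vertices inj₂ j = y_j); E i j means x_i y_j is an edge.
bipEdge : {s t : ℕ} → (Fin s → Fin t → Set) → Fin s ⊎ Fin t → Fin s ⊎ Fin t → Set
bipEdge E (inj₁ i) (inj₂ j) = E i j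
bipEdge E _        _        = ⊥

Bip : {s t : ℕ} → (Fin s → Fin t → Set) → Graph
Bip {s} {t} E = record { V = Fin s ⊎ Fin t ; Adj = Sym (bipEdge E) }

-- G ≅ H₁ ⊕ H₂: the edge sets E₁, E₂ of H₁, H₂ partition the edge set E of G.
IsDecomposition : {s t : ℕ} → (E E₁ E₂ : Fin s → Fin t → Set) → Set
IsDecomposition E E₁ E₂ =
  ∀ i j → (E i j ⇔ (E₁ i j ⊎ E₂ i j)) × ¬ (E₁ i j × E₂ i j)

-- K_{1,n}^l: centre inj₁ tt, leaves inj₂ k (k : Fin n), loop at the centre.
starLEdge : {n : ℕ} → ⊤ ⊎ Fin n → ⊤ ⊎ Fin n → Set
starLEdge (inj₁ _) (inj₁ _) = ⊤
starLEdge (inj₁ _) (inj₂ _) = ⊤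
starLEdge (inj₂ _) _        = ⊥

K1nl : ℕ → Graph
K1nl n = record { V = ⊤ ⊎ Fin n ; Adj = Sym (starLEdge {n}) }

-- S_{2n}(G; H₁, H₂).  Vertices: inj₁ v  (v ∈ X ∪ Y, original vertex),
-- inj₂ (k , inj₁ i) = x_i^k,  inj₂ (k , inj₂ j) = y_j^k.
SVert : ℕ → ℕ → ℕ → Set
SVert s t n = (Fin s ⊎ Fin t) ⊎ (Fin n × (Fin s ⊎ Fin t))

SEdge : {s t n : ℕ} → (E E₁ E₂ : Fin s → Fin t → Set) → SVert s t n → SVert s t n → Set
SEdge E E₁ E₂ (inj₁ (inj₁ i)) (inj₁ (inj₂ j))       = E i j
SEdge E E₁ E₂ (inj₁ (inj₁ i)) (inj₂ (k , inj₂ j))   = E₁ i j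
SEdge E E₁ E₂ (inj₂ (k , inj₁ i)) (inj₁ (inj₂ j))   = E₂ i j
SEdge E E₁ E₂ _ _ = ⊥

S2n : {s t : ℕ} → (n : ℕ) → (E E₁ E₂ : Fin s → Fin t → Set) → Graph
S2n {s} {t} n E E₁ E₂ = record { V = SVert s t n ; Adj = Sym (SEdge {s} {t} {n} E E₁ E₂) }

module Submission where

-- Orient each edge x_i y_j of G from X to Y when it lies in H₁
-- and from Y to X when it lies in H₂; this is an orientation precisely
-- because E₁, E₂ partition E.  Orient K_{1,n}^l away from its centre c (the
-- loop at c stays a loop).  An arc of the tensor product needs an arc of the
-- star in its second coordinate, which must start at c; hence its arcs are
--   (u , c) → (v , c)  for u → v in G  (a copy of G), and
--   (u , c) → (v , k)  for u → v in G  (x_i → y_j^k for H₁-edges and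
--                                       y_j → x_i^k for H₂-edges),
-- which is the edge set of S_{2n}(G; H₁, H₂) under v ↦ (v , c), v^k ↦ (v , k).

open import Defs
open import Data.Nat using (ℕ; _≤_)
open import Data.Fin using (Fin)
open import Data.Product using (Σ; _×_; _,_; proj₁; proj₂)
open import Data.Sum using (_⊎_; inj₁; inj₂) renaming (map to ⊎-map; swap to ⊎-swap)
open import Data.Unit using (⊤; tt)
open import Data.Empty using (⊥; ⊥-elim)
open import Function.Bundles using (_↔_; _⇔_; Inverse; Equivalence; mk⇔; mk↔ₛ′)
open import Relation.Binary.PropositionalEquality using (_≡_; refl)

symGraph : (A : Set) → (A → A → Set) → Graph
symGraph A R = record { V = A ; Adj = Sym R }

Sym-⇔ : {A : Set} {R Q : A → A → Set} →
  (∀ u v → R u v → Sym Q u v) → (∀ u v → Q u v → Sym R u v) →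
  ∀ u v → Sym R u v ⇔ Sym Q u v
Sym-⇔ R⊆Q Q⊆R u v = mk⇔ (close R⊆Q) (close Q⊆R)
  where
  close : ∀ {P P′} → (∀ u v → P u v → Sym P′ u v) → Sym P u v → Sym P′ u v
  close P⊆P′ (inj₁ p) = P⊆P′ u v p
  close P⊆P′ (inj₂ p) = ⊎-swap (P⊆P′ v u p)

Sym-≅ : {A B : Set} {R : A → A → Set} {Q : B → B → Set} (f : A ↔ B) →
  (∀ u v → R u v → Sym Q (Inverse.to f u) (Inverse.to f v)) →
  (∀ u v → Q (Inverse.to f u) (Inverse.to f v) → Sym R u v) →
  symGraph A R ≅ symGraph B Q
Sym-≅ f R⊆Q Q⊆R = f , Sym-⇔ R⊆Q Q⊆R

orientation : {A : Set} {R Q : A → A → Set} →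
  (∀ u v → R u v → Sym Q u v) → (∀ u v → Q u v → Sym R u v) →
  (∀ u v → Q u v → Q v u → u ≡ v) →
  IsOrientation (symGraph A R) Q
orientation R⊆Q Q⊆R antisym = Sym-⇔ R⊆Q Q⊆R , antisym

layers : {A B : Set} → (A ⊎ (B × A)) ↔ (A × (⊤ ⊎ B))
layers {A} {B} = mk↔ₛ′ split join split∘join join∘split
  where
  split : A ⊎ (B × A) → A × (⊤ ⊎ B)
  split (inj₁ a)       = a , inj₁ tt
  split (inj₂ (k , a)) = a , inj₂ k
  join : A × (⊤ ⊎ B) → A ⊎ (B × A)
  join (a , inj₁ _) = inj₁ a
  join (a , inj₂ k) = inj₂ (k , a)
  split∘join : ∀ p → split (join p) ≡ p
  split∘join (a , inj₁ _) = refl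
  split∘join (a , inj₂ k) = refl
  join∘split : ∀ x → join (split x) ≡ x
  join∘split (inj₁ a)       = refl
  join∘split (inj₂ (k , a)) = refl

-- The star K_{1,n}^l oriented away from its centre; the loop is its own
-- reversal, so the only pair of opposite arcs is the loop.
star-orientation : (n : ℕ) → IsOrientation (K1nl n) (starLEdge {n})
star-orientation n = orientation (λ _ _ → inj₁) (λ _ _ → inj₁) antisym
  where
  antisym : ∀ u v → starLEdge {n} u v → starLEdge v u → u ≡ v
  antisym (inj₁ tt) (inj₁ tt) _ _ = refl

module _ {s t : ℕ} (n : ℕ) (E E₁ E₂ : Fin s → Fin t → Set)
         (dec : IsDecomposition E E₁ E₂) where

  split-edge : ∀ i j → E i j → E₁ i j ⊎ E₂ i j
  split-edge i j = Equivalence.to (proj₁ (dec i j))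

  join-edge : ∀ i j → E₁ i j ⊎ E₂ i j → E i j
  join-edge i j = Equivalence.from (proj₁ (dec i j))

  arcG : Fin s ⊎ Fin t → Fin s ⊎ Fin t → Set
  arcG (inj₁ i) (inj₂ j) = E₁ i j
  arcG (inj₂ j) (inj₁ i) = E₂ i j
  arcG (inj₁ _) (inj₁ _) = ⊥
  arcG (inj₂ _) (inj₂ _) = ⊥

  -- Each edge of G lies in exactly one of H₁, H₂, hence gets exactly one
  -- direction.
  G-orientation : IsOrientation (Bip E) arcG
  G-orientation = orientation edge⇒arc arc⇒edge antisym
    where
    edge⇒arc : ∀ u v → bipEdge E u v → Sym arcG u v
    edge⇒arc (inj₁ i) (inj₂ j) = split-edge i j
    arc⇒edge : ∀ u v → arcG u v → Sym (bipEdge E) u v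
    arc⇒edge (inj₁ i) (inj₂ j) e = inj₁ (join-edge i j (inj₁ e))
    arc⇒edge (inj₂ j) (inj₁ i) e = inj₂ (join-edge i j (inj₂ e))
    antisym : ∀ u v → arcG u v → arcG v u → u ≡ v
    antisym (inj₁ i) (inj₂ j) e₁ e₂ = ⊥-elim (proj₂ (dec i j) (e₁ , e₂))
    antisym (inj₂ j) (inj₁ i) e₂ e₁ = ⊥-elim (proj₂ (dec i j) (e₁ , e₂))

  Tensor : Digraph
  Tensor = dig (Bip E) arcG ⊗ dig (K1nl n) (starLEdge {n})

  SE : SVert s t n → SVert s t n → Set
  SE = SEdge {s} {t} {n} E E₁ E₂

  tensorArc : SVert s t n → SVert s t n → Set
  tensorArc u v = Arc Tensor (Inverse.to layers u) (Inverse.to layers v)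

  -- Every edge of S_{2n} is a tensor arc (in one of the two directions):
  -- edges of G lie on layer c, the new edges go from layer c to a leaf.
  S⇒tensor : ∀ u v → SE u v → Sym tensorArc u v
  S⇒tensor (inj₁ (inj₁ i)) (inj₁ (inj₂ j))     e =
    ⊎-map (_, tt) (_, tt) (split-edge i j e)
  S⇒tensor (inj₁ (inj₁ i)) (inj₂ (k , inj₂ j)) e = inj₁ (e , tt)
  S⇒tensor (inj₂ (k , inj₁ i)) (inj₁ (inj₂ j)) e = inj₂ (e , tt)

  -- Every tensor arc starts on layer c and is an edge of S_{2n}.
  tensor⇒S : ∀ u v → tensorArc u v → Sym SE u v
  tensor⇒S (inj₁ (inj₁ i)) (inj₁ (inj₂ j))     (e , _) = inj₁ (join-edge i j (inj₁ e))
  tensor⇒S (inj₁ (inj₂ j)) (inj₁ (inj₁ i))     (e , _) = inj₂ (join-edge i j (inj₂ e))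
  tensor⇒S (inj₁ (inj₁ i)) (inj₂ (k , inj₂ j)) (e , _) = inj₁ e
  tensor⇒S (inj₁ (inj₂ j)) (inj₂ (k , inj₁ i)) (e , _) = inj₂ e

  S≅tensor : S2n n E E₁ E₂ ≅ und Tensor
  S≅tensor = Sym-≅ {R = SE} {Q = Arc Tensor} layers S⇒tensor tensor⇒S

lemma3p3 : {s t : ℕ} (n : ℕ) (E E₁ E₂ : Fin s → Fin t → Set) →
    1 ≤ n → IsDecomposition E E₁ E₂ →
    Σ (V (Bip E) → V (Bip E) → Set) λ AG →
    Σ (V (K1nl n) → V (K1nl n) → Set) λ AK →
    IsOrientation (Bip E) AG × IsOrientation (K1nl n) AK ×
    (S2n n E E₁ E₂ ≅ und (dig (Bip E) AG ⊗ dig (K1nl n) AK))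
lemma3p3 n E E₁ E₂ _ dec =
  arcG n E E₁ E₂ dec , starLEdge ,
  G-orientation n E E₁ E₂ dec , star-orientation n , S≅tensor n E E₁ E₂ dec
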